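{- Let $g:\mathbb{F}_2^n\to\mathbb{F}_2$ be an arbitrary Boolean function and $\Pi:\mathbb{F}_2^n\to\mathbb{F}_2^n$ a map, and define $f:\mathbb{F}_2^n\times\mathbb{F}_2^n\to\mathbb{F}_2$ by $f(x,y)=\langle x,\Pi(y)\rangle+g(y)$. Let $\Lambda$ be any subset of the index set of the variables $y_0,\dots,y_{n-1}$. Then $f$ is shifted-bent with respect to $\Lambda$ if and only if $\Pi$ is a permutation of $\mathbb{F}_2^n$.
   Context: $\langle x,y\rangle=\sum_i x_iy_i$. A Boolean function $F:\mathbb{F}_2^m\to\mathbb{F}_2$ is balanced if it takes the values $0$ and $1$ equally often. $F$ is shifted-bent with respect to $\Lambda\subseteq\{0,\dots,m-1\}$ if for every nonzero $a\in\mathbb{F}_2^m$ the function $z\mapsto F(z+a)+F(z)+\sum_{i\in\Lambda}z_ia_i$ is balanced. Here $m=2n$ and the coordinates of $z=(x,y)$ are $x_0,\dots,x_{n-1},y_0,\dots,y_{n-1}$; $\Lambda$ consists only of positions of $y$-coordinates. -}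

module Defs where

open import Data.Bool using (Bool; _≟_; true; false; _xor_; _∧_; if_then_else_)
open import Data.Nat using (ℕ; zero; suc; _+_)
open import Data.Fin using (Fin)
open import Data.Vec using (Vec; []; _∷_; _++_; zipWith; foldr; lookup; take; drop; replicate)
import Data.Vec as Vec
open import Data.List using (List; []; _∷_; concatMap; length; filter)
open import Data.Fin.Subset using (Subset; inside; outside)
open import Relation.Binary.PropositionalEquality using (_≡_)
open import Relation.Nullary using (¬_)
open import Function.Definitions using (Bijective)

-- F₂ is modelled by Bool, addition is xor, multiplication is ∧.
F₂ : Set
F₂ = Bool

F₂^ : ℕ → Set
F₂^ n = Vec Bool n

_⊕_ : ∀ {n} → F₂^ n → F₂^ n → F₂^ n
_⊕_ = zipWith _xor_

𝟎 : ∀ {n} → F₂^ n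
𝟎 = replicate _ false

⟨_,_⟩ : ∀ {n} → F₂^ n → F₂^ n → F₂
⟨ x , y ⟩ = foldr _ _xor_ false (zipWith _∧_ x y)

allVecs : (n : ℕ) → List (F₂^ n)
allVecs zero = [] ∷ []
allVecs (suc n) = concatMap (λ v → Vec._∷_ false v ∷ Vec._∷_ true v ∷ []) (allVecs n)

count : ∀ {m} → (F₂^ m → F₂) → F₂ → ℕ
count {m} F b = length (filter (λ z → F z ≟ b) (allVecs m))

Balanced : ∀ {m} → (F₂^ m → F₂) → Set
Balanced F = count F false ≡ count F true

partialDot : ∀ {m} → Subset m → F₂^ m → F₂^ m → F₂
partialDot Λ z a = ⟨ zipWith _∧_ Λ z , a ⟩

ShiftedBent : ∀ {m} → Subset m → (F₂^ m → F₂) → Set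
ShiftedBent Λ F = ∀ a → ¬ (a ≡ 𝟎) →
  Balanced (λ z → (F (z ⊕ a) xor F z) xor partialDot Λ z a)

-- a subset of the y-positions {n,…,2n-1} of z = (x,y) ∈ F₂^(n+n):
-- Λ_y ⊆ {0,…,n-1} indexes y_0,…,y_{n-1}; no x-position is included
yPositions : ∀ {n} → Subset n → Subset (n + n)
yPositions {n} Λy = replicate n outside ++ Λy

uncurryVec : ∀ {n} → (F₂^ n → F₂^ n → F₂) → F₂^ (n + n) → F₂
uncurryVec {n} f z = f (take n z) (drop n z)

mmF : ∀ {n} → (F₂^ n → F₂^ n) → (F₂^ n → F₂) → F₂^ n → F₂^ n → F₂
mmF Π g x y = ⟨ x , Π y ⟩ xor g y

IsPermutation : ∀ {n} → (F₂^ n → F₂^ n) → Set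
IsPermutation = Bijective _≡_ _≡_

module Submission where

open import Defs
open import Data.Bool using (true; false; not; _xor_; _∧_)
import Data.Bool as Bool
open import Data.Bool.Properties
  using (∧-comm; ∧-distribʳ-xor; xor-comm; xor-assoc; xor-same; xor-identityʳ;
         not-injective; xor-∧-commutativeRing)
open import Data.Nat using (ℕ; zero; suc; _^_; s≤s; z≤n)
import Data.Nat as ℕ
import Data.Nat.Properties as ℕ
open import Data.Integer using (ℤ; +_; _+_; _*_; -_; _-_; 0ℤ; 1ℤ; -1ℤ; _≤_; +≤+)
open import Data.Integer.Properties
  using (+-identityˡ; +-identityʳ; +-assoc; +-inverseʳ; +-injective; +-mono-≤;
         *-identityˡ; *-identityʳ; *-zeroʳ; *-comm; *-assoc; *-distribˡ-+; *-distribʳ-+;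
         *-cancelˡ-≡; -1*i≡-i; pos-+; i-j≡0⇒i≡j; ≤-reflexive; ≤-antisym; module ≤-Reasoning)
open import Data.Integer.Tactic.RingSolver using (solve-∀)
open import Data.Vec using ([]; _∷_; _++_; zipWith; take; drop; splitAt)
open import Data.Vec.Properties using (≡-dec; zipWith-++; zipWith-comm; ∷-injective; ++-injectiveˡ)
open import Data.List using (List; []; _∷_; length; filter)
import Data.List as List
open import Data.Fin.Subset using (Subset)
open import Data.Product using (∃; _,_; proj₁)
open import Relation.Nullary using (¬_; Dec; yes; no; contradiction)
open import Relation.Binary.Definitions using (DecidableEquality)
open import Relation.Binary.PropositionalEquality
open import Function.Base using (_∘_)
open import Function.Bundles using (_⇔_; mk⇔; Equivalence)
open import Function.Definitions using (Injective)
open import Algebra.Bundles using (CommutativeRing)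
open import Algebra.Solver.CommutativeMonoid (CommutativeRing.+-commutativeMonoid xor-∧-commutativeRing)
  using (solve; _⊜_) renaming (_⊕_ to _⊻_)

-- With signs χ(b) = (-1)^b, F is balanced iff Σ χ(F) = 0.  For a = (a₁,a₂) and
-- z = (x,y) the shifted derivative of f is ⟨x, Π(y+a₂) + Π(y)⟩ plus a term
-- depending on y only (this is where Λ ⊆ y-positions matters), so its sign sum
-- is Σ_y ± Σ_x χ⟨x, Π(y+a₂) + Π(y)⟩.  For a₂ ≠ 0 and Π injective every inner sum
-- vanishes; for a₂ = 0 the sum is 2^n Σ_y χ⟨a₁, Π(y)⟩.  So in both directions the
-- question is whether every component ⟨a₁, Π⟩ with a₁ ≠ 0 is balanced, and by
-- Fourier inversion, 2^n |Π⁻¹(c)| = Σ_a χ⟨a,c⟩ Σ_y χ⟨a,Π(y)⟩, this is the case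
-- exactly when every fibre of Π is a singleton.

χ : F₂ → ℤ
χ false = 1ℤ
χ true  = -1ℤ

χ-xor : ∀ p q → χ (p xor q) ≡ χ p * χ q
χ-xor false q     = sym (*-identityˡ (χ q))
χ-xor true  false = refl
χ-xor true  true  = refl

χ-not : ∀ p → χ (not p) ≡ - χ p
χ-not false = refl
χ-not true  = refl

∑ : ∀ n → (F₂^ n → ℤ) → ℤ
∑ zero    f = f []
∑ (suc n) f = ∑ n (λ v → f (false ∷ v)) + ∑ n (λ v → f (true ∷ v))

∑-++ : ∀ n {m} (f : F₂^ (n ℕ.+ m) → ℤ) → ∑ (n ℕ.+ m) f ≡ ∑ n (λ x → ∑ m (λ y → f (x ++ y)))
∑-++ zero    f = refl
∑-++ (suc n) f = cong₂ _+_ (∑-++ n _) (∑-++ n _)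

∑-cong : ∀ n {f h : F₂^ n → ℤ} → (∀ v → f v ≡ h v) → ∑ n f ≡ ∑ n h
∑-cong zero    f≡h = f≡h []
∑-cong (suc n) f≡h = cong₂ _+_ (∑-cong n (f≡h ∘ (false ∷_))) (∑-cong n (f≡h ∘ (true ∷_)))

∑-distrib-+ : ∀ n (f h : F₂^ n → ℤ) → ∑ n (λ v → f v + h v) ≡ ∑ n f + ∑ n h
∑-distrib-+ zero    f h = refl
∑-distrib-+ (suc n) f h
  rewrite ∑-distrib-+ n (f ∘ (false ∷_)) (h ∘ (false ∷_))
        | ∑-distrib-+ n (f ∘ (true ∷_)) (h ∘ (true ∷_))
  = middleFour (∑ n (f ∘ (false ∷_))) (∑ n (h ∘ (false ∷_))) (∑ n (f ∘ (true ∷_))) (∑ n (h ∘ (true ∷_)))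
  where
  middleFour : ∀ a b c d → (a + b) + (c + d) ≡ (a + c) + (b + d)
  middleFour = solve-∀

∑-*ˡ : ∀ n c (f : F₂^ n → ℤ) → ∑ n (λ v → c * f v) ≡ c * ∑ n f
∑-*ˡ zero    c f = refl
∑-*ˡ (suc n) c f
  rewrite ∑-*ˡ n c (f ∘ (false ∷_)) | ∑-*ˡ n c (f ∘ (true ∷_))
  = sym (*-distribˡ-+ c _ _)

∑-*ʳ : ∀ n c (f : F₂^ n → ℤ) → ∑ n (λ v → f v * c) ≡ ∑ n f * c
∑-*ʳ n c f = begin
  ∑ n (λ v → f v * c)  ≡⟨ ∑-cong n (λ v → *-comm (f v) c) ⟩
  ∑ n (λ v → c * f v)  ≡⟨ ∑-*ˡ n c f ⟩
  c * ∑ n f            ≡⟨ *-comm c _ ⟩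
  ∑ n f * c            ∎
  where open ≡-Reasoning

∑-neg : ∀ n (f : F₂^ n → ℤ) → ∑ n (λ v → - f v) ≡ - ∑ n f
∑-neg n f = begin
  ∑ n (λ v → - f v)      ≡⟨ ∑-cong n (λ v → sym (-1*i≡-i (f v))) ⟩
  ∑ n (λ v → -1ℤ * f v)  ≡⟨ ∑-*ˡ n -1ℤ f ⟩
  -1ℤ * ∑ n f            ≡⟨ -1*i≡-i _ ⟩
  - ∑ n f                ∎
  where open ≡-Reasoning

∑-zero : ∀ n → ∑ n (λ _ → 0ℤ) ≡ 0ℤ
∑-zero zero    = refl
∑-zero (suc n) rewrite ∑-zero n = refl

∑-const : ∀ n c → ∑ n (λ _ → c) ≡ + 2 ^ n * c
∑-const zero    c = sym (*-identityˡ c)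
∑-const (suc n) c = begin
  ∑ n (λ _ → c) + ∑ n (λ _ → c)  ≡⟨ cong₂ _+_ (∑-const n c) (∑-const n c) ⟩
  + 2 ^ n * c + + 2 ^ n * c      ≡⟨ sym (*-distribʳ-+ c (+ 2 ^ n) (+ 2 ^ n)) ⟩
  (+ 2 ^ n + + 2 ^ n) * c        ≡⟨ cong (_* c) (sym (pos-+ (2 ^ n) (2 ^ n))) ⟩
  + (2 ^ n ℕ.+ 2 ^ n) * c        ≡⟨ cong (λ k → + (2 ^ n ℕ.+ k) * c) (sym (ℕ.+-identityʳ (2 ^ n))) ⟩
  + 2 ^ suc n * c                ∎
  where open ≡-Reasoning

∑-comm : ∀ n m (f : F₂^ n → F₂^ m → ℤ) →
         ∑ n (λ x → ∑ m (λ y → f x y)) ≡ ∑ m (λ y → ∑ n (λ x → f x y))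
∑-comm zero    m f = refl
∑-comm (suc n) m f
  rewrite ∑-comm n m (f ∘ (false ∷_)) | ∑-comm n m (f ∘ (true ∷_))
  = sym (∑-distrib-+ m _ _)

∑-mono-≤ : ∀ n {f h : F₂^ n → ℤ} → (∀ v → f v ≤ h v) → ∑ n f ≤ ∑ n h
∑-mono-≤ zero    f≤h = f≤h []
∑-mono-≤ (suc n) f≤h = +-mono-≤ (∑-mono-≤ n (f≤h ∘ (false ∷_))) (∑-mono-≤ n (f≤h ∘ (true ∷_)))

∑≢0⇒∃≢0 : ∀ n (f : F₂^ n → ℤ) → ¬ ∑ n f ≡ 0ℤ → ∃ λ v → ¬ f v ≡ 0ℤ
∑≢0⇒∃≢0 zero    f ∑≢0 = [] , ∑≢0
∑≢0⇒∃≢0 (suc n) f ∑≢0 with ∑ n (f ∘ (false ∷_)) Data.Integer.≟ 0ℤ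
... | no  ∑₀≢0 = let v , fv≢0 = ∑≢0⇒∃≢0 n (f ∘ (false ∷_)) ∑₀≢0 in false ∷ v , fv≢0
... | yes ∑₀≡0 = let v , fv≢0 = ∑≢0⇒∃≢0 n (f ∘ (true ∷_)) ∑₁≢0 in true ∷ v , fv≢0
  where
  ∑₁≢0 : ¬ ∑ n (f ∘ (true ∷_)) ≡ 0ℤ
  ∑₁≢0 ∑₁≡0 = ∑≢0 (cong₂ _+_ ∑₀≡0 ∑₁≡0)

∑ᴸ : ∀ {A : Set} → List A → (A → ℤ) → ℤ
∑ᴸ []      h = 0ℤ
∑ᴸ (z ∷ L) h = h z + ∑ᴸ L h

∑ᴸ-++ : ∀ {A : Set} (L M : List A) h → ∑ᴸ (L List.++ M) h ≡ ∑ᴸ L h + ∑ᴸ M h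
∑ᴸ-++ []      M h = sym (+-identityˡ _)
∑ᴸ-++ (z ∷ L) M h rewrite ∑ᴸ-++ L M h = sym (+-assoc (h z) _ _)

∑ᴸ-allVecs : ∀ n h → ∑ᴸ (allVecs n) h ≡ ∑ n h
∑ᴸ-allVecs zero    h = +-identityʳ (h [])
∑ᴸ-allVecs (suc n) h = begin
  ∑ᴸ (allVecs (suc n)) h                             ≡⟨ ∑ᴸ-extend (allVecs n) ⟩
  ∑ᴸ (allVecs n) (λ v → h (false ∷ v) + h (true ∷ v)) ≡⟨ ∑ᴸ-allVecs n _ ⟩
  ∑ n (λ v → h (false ∷ v) + h (true ∷ v))            ≡⟨ ∑-distrib-+ n _ _ ⟩
  ∑ (suc n) h                                        ∎
  where
  open ≡-Reasoning
  extend : F₂^ n → List (F₂^ (suc n))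
  extend v = (false ∷ v) ∷ (true ∷ v) ∷ []
  ∑ᴸ-extend : ∀ L → ∑ᴸ (List.concatMap extend L) h ≡ ∑ᴸ L (λ v → h (false ∷ v) + h (true ∷ v))
  ∑ᴸ-extend []      = refl
  ∑ᴸ-extend (v ∷ L)
    rewrite ∑ᴸ-++ (extend v) (List.concatMap extend L) h | ∑ᴸ-extend L | +-identityʳ (h (true ∷ v))
    = refl

occurrences : ∀ {A : Set} → (A → F₂) → F₂ → List A → ℕ
occurrences F b L = length (filter (λ z → F z Bool.≟ b) L)

signedCount : ∀ {A : Set} (F : A → F₂) (L : List A) →
  + occurrences F false L - + occurrences F true L ≡ ∑ᴸ L (χ ∘ F)
signedCount F []      = refl
signedCount F (z ∷ L) with F z
... | false = trans (+-assoc 1ℤ (+ occurrences F false L) (- + occurrences F true L))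
                    (cong (_+_ 1ℤ) (signedCount F L))
... | true  = trans (oneMore (+ occurrences F false L) (+ occurrences F true L))
                    (cong (_+_ -1ℤ) (signedCount F L))
  where
  oneMore : ∀ a b → a - (1ℤ + b) ≡ -1ℤ + (a - b)
  oneMore = solve-∀

balanced⇔∑χ≡0 : ∀ {m} (F : F₂^ m → F₂) → Balanced F ⇔ (∑ m (χ ∘ F) ≡ 0ℤ)
balanced⇔∑χ≡0 {m} F = mk⇔ to from
  where
  ∑χ≡count-count : ∑ m (χ ∘ F) ≡ + count F false - + count F true
  ∑χ≡count-count = sym (trans (signedCount F (allVecs m)) (∑ᴸ-allVecs m (χ ∘ F)))
  to : Balanced F → ∑ m (χ ∘ F) ≡ 0ℤ
  to balanced = begin
    ∑ m (χ ∘ F)                         ≡⟨ ∑χ≡count-count ⟩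
    + count F false - + count F true    ≡⟨ cong (λ k → + k - + count F true) balanced ⟩
    + count F true - + count F true     ≡⟨ +-inverseʳ (+ count F true) ⟩
    0ℤ                                  ∎
    where open ≡-Reasoning
  from : ∑ m (χ ∘ F) ≡ 0ℤ → Balanced F
  from ∑χ≡0 = +-injective (i-j≡0⇒i≡j _ _ (trans (sym ∑χ≡count-count) ∑χ≡0))

_≟ᵥ_ : ∀ {n} → DecidableEquality (F₂^ n)
_≟ᵥ_ = ≡-dec Bool._≟_

⊕-comm : ∀ {n} (u v : F₂^ n) → u ⊕ v ≡ v ⊕ u
⊕-comm = zipWith-comm xor-comm

⊕-identityʳ : ∀ {n} (u : F₂^ n) → u ⊕ 𝟎 ≡ u
⊕-identityʳ []      = refl
⊕-identityʳ (b ∷ u) = cong₂ _∷_ (xor-identityʳ b) (⊕-identityʳ u)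

⊕-self : ∀ {n} (u : F₂^ n) → u ⊕ u ≡ 𝟎
⊕-self []      = refl
⊕-self (b ∷ u) = cong₂ _∷_ (xor-same b) (⊕-self u)

⊕-cancelˡ : ∀ {n} (w : F₂^ n) {u v : F₂^ n} → w ⊕ u ≡ w ⊕ v → u ≡ v
⊕-cancelˡ []      {[]}    {[]}    _ = refl
⊕-cancelˡ (b ∷ w) {c ∷ u} {d ∷ v} e =
  let b⊕c≡b⊕d , w⊕u≡w⊕v = ∷-injective e in cong₂ _∷_ (xor-cancelˡ b b⊕c≡b⊕d) (⊕-cancelˡ w w⊕u≡w⊕v)
  where
  xor-cancelˡ : ∀ b {c d} → b xor c ≡ b xor d → c ≡ d
  xor-cancelˡ false e = e
  xor-cancelˡ true  e = not-injective e

⊕≡𝟎⇒≡ : ∀ {n} (u v : F₂^ n) → u ⊕ v ≡ 𝟎 → u ≡ v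
⊕≡𝟎⇒≡ u v u⊕v≡𝟎 = ⊕-cancelˡ v (trans (⊕-comm v u) (trans u⊕v≡𝟎 (sym (⊕-self v))))

⊕≡self⇒≡𝟎 : ∀ {n} (u a : F₂^ n) → u ⊕ a ≡ u → a ≡ 𝟎
⊕≡self⇒≡𝟎 u a u⊕a≡u = ⊕-cancelˡ u (trans u⊕a≡u (sym (⊕-identityʳ u)))

𝟎++𝟎 : ∀ n {m} → 𝟎 {n} ++ 𝟎 {m} ≡ 𝟎
𝟎++𝟎 zero    = refl
𝟎++𝟎 (suc n) = cong (false ∷_) (𝟎++𝟎 n)

𝟎∧ : ∀ {n} (u : F₂^ n) → zipWith _∧_ 𝟎 u ≡ 𝟎
𝟎∧ []      = refl
𝟎∧ (_ ∷ u) = cong (false ∷_) (𝟎∧ u)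

⟨⟩-comm : ∀ {n} (u v : F₂^ n) → ⟨ u , v ⟩ ≡ ⟨ v , u ⟩
⟨⟩-comm []      []      = refl
⟨⟩-comm (b ∷ u) (c ∷ v) = cong₂ _xor_ (∧-comm b c) (⟨⟩-comm u v)

⟨⟩-zeroˡ : ∀ {n} (u : F₂^ n) → ⟨ 𝟎 , u ⟩ ≡ false
⟨⟩-zeroˡ []      = refl
⟨⟩-zeroˡ (_ ∷ u) = ⟨⟩-zeroˡ u

⟨⟩-zeroʳ : ∀ {n} (u : F₂^ n) → ⟨ u , 𝟎 ⟩ ≡ false
⟨⟩-zeroʳ u = trans (⟨⟩-comm u 𝟎) (⟨⟩-zeroˡ u)

⟨⟩-distribˡ-⊕ : ∀ {n} (u v w : F₂^ n) → ⟨ u ⊕ v , w ⟩ ≡ ⟨ u , w ⟩ xor ⟨ v , w ⟩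
⟨⟩-distribˡ-⊕ []      []      []      = refl
⟨⟩-distribˡ-⊕ (b ∷ u) (c ∷ v) (d ∷ w) = begin
  ((b xor c) ∧ d) xor ⟨ u ⊕ v , w ⟩
    ≡⟨ cong₂ _xor_ (∧-distribʳ-xor d b c) (⟨⟩-distribˡ-⊕ u v w) ⟩
  ((b ∧ d) xor (c ∧ d)) xor (⟨ u , w ⟩ xor ⟨ v , w ⟩)
    ≡⟨ solve 4 (λ p q r s → (p ⊻ q) ⊻ (r ⊻ s) ⊜ (p ⊻ r) ⊻ (q ⊻ s)) refl (b ∧ d) (c ∧ d) ⟨ u , w ⟩ ⟨ v , w ⟩ ⟩
  ((b ∧ d) xor ⟨ u , w ⟩) xor ((c ∧ d) xor ⟨ v , w ⟩) ∎
  where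
  open ≡-Reasoning

⟨⟩-distribʳ-⊕ : ∀ {n} (u v w : F₂^ n) → ⟨ u , v ⊕ w ⟩ ≡ ⟨ u , v ⟩ xor ⟨ u , w ⟩
⟨⟩-distribʳ-⊕ u v w
  rewrite ⟨⟩-comm u (v ⊕ w) | ⟨⟩-comm u v | ⟨⟩-comm u w = ⟨⟩-distribˡ-⊕ v w u

⟨⟩-++ : ∀ {n m} (u w : F₂^ n) (v t : F₂^ m) → ⟨ u ++ v , w ++ t ⟩ ≡ ⟨ u , w ⟩ xor ⟨ v , t ⟩
⟨⟩-++ []      []      v t = refl
⟨⟩-++ (b ∷ u) (c ∷ w) v t rewrite ⟨⟩-++ u w v t = sym (xor-assoc (b ∧ c) ⟨ u , w ⟩ ⟨ v , t ⟩)

take-++ : ∀ n {m} (u : F₂^ n) (v : F₂^ m) → take n (u ++ v) ≡ u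
take-++ zero    []      v = refl
take-++ (suc n) (b ∷ u) v = cong (b ∷_) (take-++ n u v)

drop-++ : ∀ n {m} (u : F₂^ n) (v : F₂^ m) → drop n (u ++ v) ≡ v
drop-++ zero    []      v = refl
drop-++ (suc n) (b ∷ u) v = drop-++ n u v

uncurryVec-++ : ∀ {n} (h : F₂^ n → F₂^ n → F₂) (x y : F₂^ n) → uncurryVec h (x ++ y) ≡ h x y
uncurryVec-++ {n} h x y = cong₂ h (take-++ n x y) (drop-++ n x y)

partialDot-yPositions : ∀ {n} (Λ : Subset n) (x y a₁ a₂ : F₂^ n) →
  partialDot (yPositions Λ) (x ++ y) (a₁ ++ a₂) ≡ partialDot Λ y a₂
partialDot-yPositions Λ x y a₁ a₂
  rewrite zipWith-++ _∧_ 𝟎 Λ x y | 𝟎∧ x | ⟨⟩-++ 𝟎 a₁ (zipWith _∧_ Λ y) a₂ | ⟨⟩-zeroˡ a₁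
  = refl

-- The Iverson bracket [u = v], by recursion on the vectors so that ∑-δ is an induction.
δ : ∀ {n} → F₂^ n → F₂^ n → ℤ
δ []          []          = 1ℤ
δ (false ∷ u) (false ∷ v) = δ u v
δ (true ∷ u)  (true ∷ v)  = δ u v
δ (false ∷ u) (true ∷ v)  = 0ℤ
δ (true ∷ u)  (false ∷ v) = 0ℤ

δ-refl : ∀ {n} (u : F₂^ n) → δ u u ≡ 1ℤ
δ-refl []          = refl
δ-refl (false ∷ u) = δ-refl u
δ-refl (true ∷ u)  = δ-refl u

δ-≢ : ∀ {n} {u v : F₂^ n} → ¬ u ≡ v → δ u v ≡ 0ℤ
δ-≢ {u = []}        {[]}        u≢v = contradiction refl u≢v
δ-≢ {u = false ∷ u} {false ∷ v} u≢v = δ-≢ (u≢v ∘ cong (false ∷_))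
δ-≢ {u = true ∷ u}  {true ∷ v}  u≢v = δ-≢ (u≢v ∘ cong (true ∷_))
δ-≢ {u = false ∷ u} {true ∷ v}  u≢v = refl
δ-≢ {u = true ∷ u}  {false ∷ v} u≢v = refl

δ≢0⇒≡ : ∀ {n} {u v : F₂^ n} → ¬ δ u v ≡ 0ℤ → u ≡ v
δ≢0⇒≡ {u = u} {v} δ≢0 with u ≟ᵥ v
... | yes u≡v = u≡v
... | no  u≢v = contradiction (δ-≢ u≢v) δ≢0

δ-mono : ∀ {n} {u v u′ v′ : F₂^ n} → (u ≡ v → u′ ≡ v′) → δ u v ≤ δ u′ v′
δ-mono {u = u} {v} {u′} {v′} implies with u ≟ᵥ v | u′ ≟ᵥ v′
... | yes refl | yes refl = ≤-reflexive (trans (δ-refl u) (sym (δ-refl u′)))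
... | yes u≡v  | no u′≢v′ = contradiction (implies u≡v) u′≢v′
... | no u≢v   | yes refl = subst₂ _≤_ (sym (δ-≢ u≢v)) (sym (δ-refl u′)) (+≤+ z≤n)
... | no u≢v   | no u′≢v′ = ≤-reflexive (trans (δ-≢ u≢v) (sym (δ-≢ u′≢v′)))

δ-resp-⇔ : ∀ {n} {u v u′ v′ : F₂^ n} → (u ≡ v ⇔ u′ ≡ v′) → δ u v ≡ δ u′ v′
δ-resp-⇔ u≡v⇔u′≡v′ =
  ≤-antisym (δ-mono (Equivalence.to u≡v⇔u′≡v′)) (δ-mono (Equivalence.from u≡v⇔u′≡v′))

∑-δ : ∀ n (d : F₂^ n) (f : F₂^ n → ℤ) → ∑ n (λ v → δ d v * f v) ≡ f d
∑-δ zero    []          f = *-identityˡ (f [])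
∑-δ (suc n) (false ∷ d) f = trans (cong₂ _+_ (∑-δ n d (f ∘ (false ∷_))) (∑-zero n)) (+-identityʳ _)
∑-δ (suc n) (true ∷ d)  f = trans (cong₂ _+_ (∑-zero n) (∑-δ n d (f ∘ (true ∷_)))) (+-identityˡ _)

∑-δ-one : ∀ n (d : F₂^ n) → ∑ n (δ d) ≡ 1ℤ
∑-δ-one n d = trans (∑-cong n (λ v → sym (*-identityʳ (δ d v)))) (∑-δ n d (λ _ → 1ℤ))

∑-character≢𝟎 : ∀ n (d : F₂^ n) → ¬ d ≡ 𝟎 → ∑ n (λ x → χ ⟨ x , d ⟩) ≡ 0ℤ
∑-character≢𝟎 zero    []          d≢𝟎 = contradiction refl d≢𝟎
∑-character≢𝟎 (suc n) (false ∷ d) d≢𝟎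
  rewrite ∑-character≢𝟎 n d (d≢𝟎 ∘ cong (false ∷_)) = refl
∑-character≢𝟎 (suc n) (true ∷ d)  d≢𝟎 = begin
  S + ∑ n (λ x → χ (not ⟨ x , d ⟩))  ≡⟨ cong (_+_ S) (trans (∑-cong n (λ x → χ-not ⟨ x , d ⟩)) (∑-neg n _)) ⟩
  S - S                              ≡⟨ +-inverseʳ S ⟩
  0ℤ                                 ∎
  where
  open ≡-Reasoning
  S : ℤ
  S = ∑ n (λ x → χ ⟨ x , d ⟩)

∑-character𝟎 : ∀ n → ∑ n (λ x → χ ⟨ x , 𝟎 ⟩) ≡ + 2 ^ n
∑-character𝟎 n = begin
  ∑ n (λ x → χ ⟨ x , 𝟎 ⟩)  ≡⟨ ∑-cong n (cong χ ∘ ⟨⟩-zeroʳ) ⟩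
  ∑ n (λ _ → 1ℤ)           ≡⟨ ∑-const n 1ℤ ⟩
  + 2 ^ n * 1ℤ             ≡⟨ *-identityʳ _ ⟩
  + 2 ^ n                  ∎
  where open ≡-Reasoning

∑-orthogonality : ∀ n (u v : F₂^ n) → ∑ n (λ x → χ ⟨ x , u ⟩ * χ ⟨ x , v ⟩) ≡ + 2 ^ n * δ u v
∑-orthogonality n u v = begin
  ∑ n (λ x → χ ⟨ x , u ⟩ * χ ⟨ x , v ⟩)
    ≡⟨ ∑-cong n (λ x → trans (sym (χ-xor ⟨ x , u ⟩ ⟨ x , v ⟩)) (cong χ (sym (⟨⟩-distribʳ-⊕ x u v)))) ⟩
  ∑ n (λ x → χ ⟨ x , u ⊕ v ⟩)
    ≡⟨ characterSum (u ≟ᵥ v) ⟩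
  + 2 ^ n * δ u v ∎
  where
  open ≡-Reasoning
  characterSum : Dec (u ≡ v) → ∑ n (λ x → χ ⟨ x , u ⊕ v ⟩) ≡ + 2 ^ n * δ u v
  characterSum (yes refl) rewrite ⊕-self u | δ-refl u = trans (∑-character𝟎 n) (sym (*-identityʳ _))
  characterSum (no u≢v)   rewrite δ-≢ u≢v | *-zeroʳ (+ 2 ^ n) =
    ∑-character≢𝟎 n (u ⊕ v) (u≢v ∘ ⊕≡𝟎⇒≡ u v)

fibreSize : ∀ {n} → (F₂^ n → F₂^ n) → F₂^ n → ℤ
fibreSize {n} Π c = ∑ n (λ y → δ (Π y) c)

permutation⇒fibreSize≡1 : ∀ {n} (Π : F₂^ n → F₂^ n) → IsPermutation Π → ∀ c → fibreSize Π c ≡ 1ℤ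
permutation⇒fibreSize≡1 {n} Π (injective , surjective) c =
  let y₀ , Π[y₀]≡c = surjective c in
  trans (∑-cong n (λ y → δ-resp-⇔ (mk⇔ (λ Πy≡c → sym (injective (trans Πy≡c (sym (Π[y₀]≡c refl)))))
                                        (λ y₀≡y → Π[y₀]≡c (sym y₀≡y)))))
        (∑-δ-one n y₀)

fibreSize≡1⇒permutation : ∀ {n} (Π : F₂^ n → F₂^ n) → (∀ c → fibreSize Π c ≡ 1ℤ) → IsPermutation Π
fibreSize≡1⇒permutation {n} Π fibre≡1 = injective , surjective
  where
  open ≤-Reasoning
  surjective : ∀ c → ∃ λ y → ∀ {z} → z ≡ y → Π z ≡ c
  surjective c =
    let y , δ≢0 = ∑≢0⇒∃≢0 n (λ y → δ (Π y) c) fibre≢0 in y , λ { refl → δ≢0⇒≡ δ≢0 }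
    where
    fibre≢0 : ¬ fibreSize Π c ≡ 0ℤ
    fibre≢0 fibre≡0 with trans (sym (fibre≡1 c)) fibre≡0
    ... | ()
  twoPoints≤fibre : ∀ {y₁ y₂} → ¬ y₁ ≡ y₂ → Π y₁ ≡ Π y₂ → ∀ y → δ y₁ y + δ y₂ y ≤ δ (Π y) (Π y₁)
  twoPoints≤fibre {y₁} {y₂} y₁≢y₂ Πy₁≡Πy₂ y with y ≟ᵥ y₁
  ... | yes refl = ≤-reflexive (trans (cong₂ _+_ (δ-refl y) (δ-≢ (y₁≢y₂ ∘ sym))) (sym (δ-refl (Π y))))
  ... | no y≢y₁ = begin
    δ y₁ y + δ y₂ y  ≡⟨ cong (_+ δ y₂ y) (δ-≢ (y≢y₁ ∘ sym)) ⟩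
    0ℤ + δ y₂ y      ≡⟨ +-identityˡ _ ⟩
    δ y₂ y           ≤⟨ δ-mono (λ y₂≡y → trans (cong Π (sym y₂≡y)) (sym Πy₁≡Πy₂)) ⟩
    δ (Π y) (Π y₁)   ∎
  injective : Injective _≡_ _≡_ Π
  injective {y₁} {y₂} Πy₁≡Πy₂ with y₁ ≟ᵥ y₂
  ... | yes y₁≡y₂ = y₁≡y₂
  ... | no  y₁≢y₂ = contradiction two≤one λ { (+≤+ (s≤s ())) }
    where
    two≤one : + 2 ≤ + 1
    two≤one = begin
      + 2                          ≡⟨ sym (cong₂ _+_ (∑-δ-one n y₁) (∑-δ-one n y₂)) ⟩
      ∑ n (δ y₁) + ∑ n (δ y₂)      ≡⟨ sym (∑-distrib-+ n _ _) ⟩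
      ∑ n (λ y → δ y₁ y + δ y₂ y)  ≤⟨ ∑-mono-≤ n (twoPoints≤fibre y₁≢y₂ Πy₁≡Πy₂) ⟩
      fibreSize Π (Π y₁)           ≡⟨ fibre≡1 (Π y₁) ⟩
      + 1                          ∎

∑-reindex : ∀ {n} (Π : F₂^ n → F₂^ n) → IsPermutation Π → (f : F₂^ n → ℤ) → ∑ n (f ∘ Π) ≡ ∑ n f
∑-reindex {n} Π perm f = begin
  ∑ n (f ∘ Π)                                 ≡⟨ ∑-cong n (λ y → sym (∑-δ n (Π y) f)) ⟩
  ∑ n (λ y → ∑ n (λ c → δ (Π y) c * f c))     ≡⟨ ∑-comm n n _ ⟩
  ∑ n (λ c → ∑ n (λ y → δ (Π y) c * f c))     ≡⟨ ∑-cong n (λ c → ∑-*ʳ n (f c) _) ⟩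
  ∑ n (λ c → fibreSize Π c * f c)             ≡⟨ ∑-cong n (λ c → cong (_* f c) (permutation⇒fibreSize≡1 Π perm c)) ⟩
  ∑ n (λ c → 1ℤ * f c)                        ≡⟨ ∑-cong n (λ c → *-identityˡ (f c)) ⟩
  ∑ n f                                       ∎
  where open ≡-Reasoning

componentSum : ∀ {n} → (F₂^ n → F₂^ n) → F₂^ n → ℤ
componentSum {n} Π a = ∑ n (λ y → χ ⟨ a , Π y ⟩)

permutation⇒componentSum≡0 : ∀ {n} (Π : F₂^ n → F₂^ n) → IsPermutation Π →
                             ∀ a → ¬ a ≡ 𝟎 → componentSum Π a ≡ 0ℤ
permutation⇒componentSum≡0 {n} Π perm a a≢𝟎 = begin
  componentSum Π a          ≡⟨ ∑-reindex Π perm (λ c → χ ⟨ a , c ⟩) ⟩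
  ∑ n (λ c → χ ⟨ a , c ⟩)   ≡⟨ ∑-cong n (λ c → cong χ (⟨⟩-comm a c)) ⟩
  ∑ n (λ c → χ ⟨ c , a ⟩)   ≡⟨ ∑-character≢𝟎 n a a≢𝟎 ⟩
  0ℤ                        ∎
  where open ≡-Reasoning

componentSum≡0⇒permutation : ∀ {n} (Π : F₂^ n → F₂^ n) →
                             (∀ a → ¬ a ≡ 𝟎 → componentSum Π a ≡ 0ℤ) → IsPermutation Π
componentSum≡0⇒permutation {n} Π componentSum≡0 =
  fibreSize≡1⇒permutation Π λ c → *-cancelˡ-≡ (+ 2 ^ n) _ _ {{ℕ.m^n≢0 2 n}} (scaledFibre c)
  where
  open ≡-Reasoning
  componentSum≡δ : ∀ a → componentSum Π a ≡ δ 𝟎 a * + 2 ^ n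
  componentSum≡δ a with a ≟ᵥ 𝟎
  ... | yes refl = begin
    ∑ n (λ y → χ ⟨ 𝟎 , Π y ⟩)  ≡⟨ ∑-cong n (cong χ ∘ ⟨⟩-zeroˡ ∘ Π) ⟩
    ∑ n (λ _ → 1ℤ)             ≡⟨ trans (∑-const n 1ℤ) (*-comm _ 1ℤ) ⟩
    1ℤ * + 2 ^ n               ≡⟨ cong (_* + 2 ^ n) (sym (δ-refl a)) ⟩
    δ 𝟎 a * + 2 ^ n            ∎
  ... | no a≢𝟎 rewrite δ-≢ (a≢𝟎 ∘ sym) = componentSum≡0 a a≢𝟎
  scaledFibre : ∀ c → + 2 ^ n * fibreSize Π c ≡ + 2 ^ n * 1ℤ
  scaledFibre c = begin
    + 2 ^ n * fibreSize Π c
      ≡⟨ sym (∑-*ˡ n (+ 2 ^ n) (λ y → δ (Π y) c)) ⟩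
    ∑ n (λ y → + 2 ^ n * δ (Π y) c)
      ≡⟨ ∑-cong n (λ y → sym (∑-orthogonality n (Π y) c)) ⟩
    ∑ n (λ y → ∑ n (λ a → χ ⟨ a , Π y ⟩ * χ ⟨ a , c ⟩))
      ≡⟨ ∑-comm n n _ ⟩
    ∑ n (λ a → ∑ n (λ y → χ ⟨ a , Π y ⟩ * χ ⟨ a , c ⟩))
      ≡⟨ ∑-cong n (λ a → ∑-*ʳ n _ _) ⟩
    ∑ n (λ a → componentSum Π a * χ ⟨ a , c ⟩)
      ≡⟨ ∑-cong n (λ a → trans (cong (_* _) (componentSum≡δ a)) (*-assoc (δ 𝟎 a) _ _)) ⟩
    ∑ n (λ a → δ 𝟎 a * (+ 2 ^ n * χ ⟨ a , c ⟩))
      ≡⟨ ∑-δ n 𝟎 _ ⟩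
    + 2 ^ n * χ ⟨ 𝟎 , c ⟩
      ≡⟨ cong (λ b → + 2 ^ n * χ b) (⟨⟩-zeroˡ c) ⟩
    + 2 ^ n * 1ℤ ∎

module MaioranaMcFarland {n : ℕ} (g : F₂^ n → F₂) (Π : F₂^ n → F₂^ n) (Λ : Subset n) where

  f : F₂^ (n ℕ.+ n) → F₂
  f = uncurryVec (mmF Π g)

  derivative : F₂^ (n ℕ.+ n) → F₂^ (n ℕ.+ n) → F₂
  derivative a z = (f (z ⊕ a) xor f z) xor partialDot (yPositions Λ) z a

  ΔΠ : F₂^ n → F₂^ n → F₂^ n
  ΔΠ a₂ y = Π (y ⊕ a₂) ⊕ Π y

  offset : F₂^ n → F₂^ n → F₂^ n → F₂
  offset a₁ a₂ y = ((⟨ a₁ , Π (y ⊕ a₂) ⟩ xor g (y ⊕ a₂)) xor g y) xor partialDot Λ y a₂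

  derivative-++ : ∀ a₁ a₂ x y → derivative (a₁ ++ a₂) (x ++ y) ≡ ⟨ x , ΔΠ a₂ y ⟩ xor offset a₁ a₂ y
  derivative-++ a₁ a₂ x y
    rewrite zipWith-++ _xor_ x y a₁ a₂
          | uncurryVec-++ (mmF Π g) (x ⊕ a₁) (y ⊕ a₂) | uncurryVec-++ (mmF Π g) x y
          | partialDot-yPositions Λ x y a₁ a₂
          | ⟨⟩-distribˡ-⊕ x a₁ (Π (y ⊕ a₂)) | ⟨⟩-distribʳ-⊕ x (Π (y ⊕ a₂)) (Π y)
    = solve 6 (λ p q r s t u → (((p ⊻ q) ⊻ r) ⊻ (s ⊻ t)) ⊻ u ⊜ (p ⊻ s) ⊻ (((q ⊻ r) ⊻ t) ⊻ u))
            refl ⟨ x , Π (y ⊕ a₂) ⟩ ⟨ a₁ , Π (y ⊕ a₂) ⟩ (g (y ⊕ a₂)) ⟨ x , Π y ⟩ (g y) (partialDot Λ y a₂)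

  ∑-derivative : ∀ a₁ a₂ → ∑ (n ℕ.+ n) (χ ∘ derivative (a₁ ++ a₂))
                           ≡ ∑ n (λ y → χ (offset a₁ a₂ y) * ∑ n (λ x → χ ⟨ x , ΔΠ a₂ y ⟩))
  ∑-derivative a₁ a₂ = begin
    ∑ (n ℕ.+ n) (χ ∘ derivative (a₁ ++ a₂))
      ≡⟨ ∑-++ n _ ⟩
    ∑ n (λ x → ∑ n (λ y → χ (derivative (a₁ ++ a₂) (x ++ y))))
      ≡⟨ ∑-cong n (λ x → ∑-cong n (λ y →
           trans (cong χ (derivative-++ a₁ a₂ x y)) (χ-xor ⟨ x , ΔΠ a₂ y ⟩ (offset a₁ a₂ y)))) ⟩
    ∑ n (λ x → ∑ n (λ y → χ ⟨ x , ΔΠ a₂ y ⟩ * sign y))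
      ≡⟨ ∑-comm n n _ ⟩
    ∑ n (λ y → ∑ n (λ x → χ ⟨ x , ΔΠ a₂ y ⟩ * sign y))
      ≡⟨ ∑-cong n (λ y → trans (∑-*ʳ n (sign y) (λ x → χ ⟨ x , ΔΠ a₂ y ⟩)) (*-comm (inner y) (sign y))) ⟩
    ∑ n (λ y → sign y * inner y) ∎
    where
    open ≡-Reasoning
    sign inner : F₂^ n → ℤ
    sign y  = χ (offset a₁ a₂ y)
    inner y = ∑ n (λ x → χ ⟨ x , ΔΠ a₂ y ⟩)

  ∑-derivative-≢𝟎 : Injective _≡_ _≡_ Π → ∀ a₁ {a₂} → ¬ a₂ ≡ 𝟎 →
                    ∑ (n ℕ.+ n) (χ ∘ derivative (a₁ ++ a₂)) ≡ 0ℤ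
  ∑-derivative-≢𝟎 injective a₁ {a₂} a₂≢𝟎 = begin
    ∑ (n ℕ.+ n) (χ ∘ derivative (a₁ ++ a₂))
      ≡⟨ ∑-derivative a₁ a₂ ⟩
    ∑ n (λ y → sign y * ∑ n (λ x → χ ⟨ x , ΔΠ a₂ y ⟩))
      ≡⟨ ∑-cong n (λ y → trans (cong (sign y *_) (∑-character≢𝟎 n (ΔΠ a₂ y) (ΔΠ≢𝟎 y))) (*-zeroʳ (sign y))) ⟩
    ∑ n (λ _ → 0ℤ)
      ≡⟨ ∑-zero n ⟩
    0ℤ ∎
    where
    open ≡-Reasoning
    sign : F₂^ n → ℤ
    sign y = χ (offset a₁ a₂ y)
    ΔΠ≢𝟎 : ∀ y → ¬ ΔΠ a₂ y ≡ 𝟎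
    ΔΠ≢𝟎 y ΔΠ≡𝟎 = a₂≢𝟎 (⊕≡self⇒≡𝟎 y a₂ (injective (⊕≡𝟎⇒≡ _ _ ΔΠ≡𝟎)))

  ∑-derivative-𝟎 : ∀ a₁ → ∑ (n ℕ.+ n) (χ ∘ derivative (a₁ ++ 𝟎)) ≡ + 2 ^ n * componentSum Π a₁
  ∑-derivative-𝟎 a₁ = begin
    ∑ (n ℕ.+ n) (χ ∘ derivative (a₁ ++ 𝟎))
      ≡⟨ ∑-derivative a₁ 𝟎 ⟩
    ∑ n (λ y → χ (offset a₁ 𝟎 y) * ∑ n (λ x → χ ⟨ x , ΔΠ 𝟎 y ⟩))
      ≡⟨ ∑-cong n (λ y → cong₂ _*_ (cong χ (offset-𝟎 y)) (innerSum y)) ⟩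
    ∑ n (λ y → χ ⟨ a₁ , Π y ⟩ * + 2 ^ n)
      ≡⟨ ∑-*ʳ n _ _ ⟩
    componentSum Π a₁ * + 2 ^ n
      ≡⟨ *-comm (componentSum Π a₁) (+ 2 ^ n) ⟩
    + 2 ^ n * componentSum Π a₁ ∎
    where
    open ≡-Reasoning
    offset-𝟎 : ∀ y → offset a₁ 𝟎 y ≡ ⟨ a₁ , Π y ⟩
    offset-𝟎 y
      rewrite ⊕-identityʳ y | ⟨⟩-zeroʳ (zipWith _∧_ Λ y) | xor-identityʳ ((⟨ a₁ , Π y ⟩ xor g y) xor g y)
            | xor-assoc ⟨ a₁ , Π y ⟩ (g y) (g y) | xor-same (g y)
      = xor-identityʳ _
    innerSum : ∀ y → ∑ n (λ x → χ ⟨ x , ΔΠ 𝟎 y ⟩) ≡ + 2 ^ n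
    innerSum y rewrite ⊕-identityʳ y | ⊕-self (Π y) = ∑-character𝟎 n

  permutation⇒∑derivative≡0 : IsPermutation Π → ∀ a → ¬ a ≡ 𝟎 → ∑ (n ℕ.+ n) (χ ∘ derivative a) ≡ 0ℤ
  permutation⇒∑derivative≡0 perm a a≢𝟎 with splitAt n a
  ... | a₁ , a₂ , refl with a₂ ≟ᵥ 𝟎
  ...   | no  a₂≢𝟎 = ∑-derivative-≢𝟎 (proj₁ perm) a₁ a₂≢𝟎
  ...   | yes refl = begin
    ∑ (n ℕ.+ n) (χ ∘ derivative (a₁ ++ 𝟎))  ≡⟨ ∑-derivative-𝟎 a₁ ⟩
    + 2 ^ n * componentSum Π a₁             ≡⟨ cong (+ 2 ^ n *_) (permutation⇒componentSum≡0 Π perm a₁ a₁≢𝟎) ⟩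
    + 2 ^ n * 0ℤ                            ≡⟨ *-zeroʳ (+ 2 ^ n) ⟩
    0ℤ                                      ∎
    where
    open ≡-Reasoning
    a₁≢𝟎 : ¬ a₁ ≡ 𝟎
    a₁≢𝟎 a₁≡𝟎 = a≢𝟎 (trans (cong (_++ 𝟎) a₁≡𝟎) (𝟎++𝟎 n))

  ∑derivative≡0⇒componentSum≡0 : (∀ a → ¬ a ≡ 𝟎 → ∑ (n ℕ.+ n) (χ ∘ derivative a) ≡ 0ℤ) →
                                 ∀ a₁ → ¬ a₁ ≡ 𝟎 → componentSum Π a₁ ≡ 0ℤ
  ∑derivative≡0⇒componentSum≡0 ∑derivative≡0 a₁ a₁≢𝟎 =
    *-cancelˡ-≡ (+ 2 ^ n) _ _ {{ℕ.m^n≢0 2 n}} (begin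
      + 2 ^ n * componentSum Π a₁             ≡⟨ sym (∑-derivative-𝟎 a₁) ⟩
      ∑ (n ℕ.+ n) (χ ∘ derivative (a₁ ++ 𝟎))  ≡⟨ ∑derivative≡0 (a₁ ++ 𝟎) a₁++𝟎≢𝟎 ⟩
      0ℤ                                      ≡⟨ sym (*-zeroʳ (+ 2 ^ n)) ⟩
      + 2 ^ n * 0ℤ                            ∎)
    where
    open ≡-Reasoning
    a₁++𝟎≢𝟎 : ¬ a₁ ++ 𝟎 ≡ 𝟎
    a₁++𝟎≢𝟎 a₁++𝟎≡𝟎 = a₁≢𝟎 (++-injectiveˡ a₁ 𝟎 (trans a₁++𝟎≡𝟎 (sym (𝟎++𝟎 n))))

theorem5p1 : (n : ℕ) (g : F₂^ n → F₂) (Π : F₂^ n → F₂^ n) (Λ : Subset n) →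
    ShiftedBent (yPositions Λ) (uncurryVec (mmF Π g)) ⇔ IsPermutation Π
theorem5p1 n g Π Λ = mk⇔
  (λ shiftedBent → componentSum≡0⇒permutation Π (∑derivative≡0⇒componentSum≡0 (λ a a≢𝟎 →
     Equivalence.to (balanced⇔∑χ≡0 (derivative a)) (shiftedBent a a≢𝟎))))
  (λ perm a a≢𝟎 → Equivalence.from (balanced⇔∑χ≡0 (derivative a)) (permutation⇒∑derivative≡0 perm a a≢𝟎))
  where open MaioranaMcFarland g Π Λ
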